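{- (1) Let $k(*) \ge 1$, $m(0) \ge 1$ and $m(1)$ be integers with $m(1) \ge (k(*)\cdot m(0))^{k(*)+1}$. Let $A' \subseteq \mathbb{N}$ with $|A'| \ge m(1)$, and for each $k < k(*)$ let $h_k : A' \to \mathbb{N}$ satisfy $h_k(i) \ge i$ for all $i \in A'$. Then there is $A'' \subseteq A'$ with $|A''| \ge m(0)$ such that for each $k < k(*)$, either for all $i, j \in A''$ with $i < j$ we have $h_k(i) \ge j$, or for all $i,j \in A''$ with $i<j$ we have $h_k(i) < j$. (2) Let $k(*), d, m(0) \ge 1$ and $m(1)$ be integers with $m(1) > d^{k(*)} m(0)^{2^{k(*)}}$. Let $A \subseteq \mathbb{N}$ with $|A| > m(1)$, and for each $k < k(*)$ let $g_k : A \to \{1,\dots,d\}$ and $f_k : A \to \mathbb{N}$. Then there is $A' \subseteq A$ with $|A'| > m(0)$ such that for each $k < k(*)$, $f_k \restriction A'$ is either constant or one-to-one, and $g_k \restriction A'$ is constant. -}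

module Defs where

open import Data.Nat using (ℕ; _<_; _≤_; _≥_)
open import Data.List using (List; length)
open import Data.List.Membership.Propositional using (_∈_)
open import Data.List.Relation.Unary.Unique.Propositional using (Unique)
open import Data.Product using (_×_)
open import Relation.Binary.PropositionalEquality using (_≡_)

-- A finite subset of ℕ is represented by a duplicate-free list; its
-- cardinality is the length of the list.
FinSet : Set
FinSet = List ℕ

_⊆ₛ_ : FinSet → FinSet → Set
B ⊆ₛ A = ∀ {x} → x ∈ B → x ∈ A

ConstantOn : (ℕ → ℕ) → FinSet → Set
ConstantOn f B = ∀ {i j} → i ∈ B → j ∈ B → f i ≡ f j

InjectiveOn : (ℕ → ℕ) → FinSet → Set
InjectiveOn f B = ∀ {i j} → i ∈ B → j ∈ B → f i ≡ f j → i ≡ j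

{-# OPTIONS --safe #-}
-- (1) Read each i as the interval [i, ℓ i]. Among m·p such intervals there are either m with a common
-- point (the largest of them) or p pairwise disjoint ones: greedily, the maximum t either lies in m
-- intervals or may be added to a disjoint family of intervals ending before t. Take ℓ i = min h_k(i)
-- over the indices k not yet known to be short. Overlapping intervals make every such h_k long;
-- on disjoint ones, pigeonholing the minimising k makes one more h_k short, at the cost of a factor
-- k(*)·m. After at most k(*) rounds every h_k is long or short.
-- (2) Pigeonhole makes g_k constant at the cost of a factor d, and greedily, among more than n² points
-- there are n + 1 on which f_k is constant or injective. Treat the coordinates k one at a time.
module Submission where

open import Defs
open import Data.Nat using (ℕ; zero; suc; _<_; _≤_; _≥_; _>_; _*_; _+_; _^_; z≤n; s≤s; _≤?_; NonZero; >-nonZero)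
import Data.Nat as ℕ
open import Data.Nat.Properties
open import Data.Nat.GeneralisedArithmetic using (fold)
open import Data.Fin using (Fin)
import Data.Fin as Fin
open import Data.List using (List; []; _∷_; length; filter; applyUpTo; allFin)
open import Data.List.Properties using (length-applyUpTo; length-tabulate; filter-notAll)
open import Data.List.Extrema.Nat using (argmin; argmin-sel; f[argmin]≤f[⊤]; f[argmin]≤f[xs]; max; argmax-sel; ⊥≤max; xs≤max)
open import Data.List.Membership.Propositional using (_∈_)
open import Data.List.Membership.Propositional.Properties using (∈-filter⁺; ∈-filter⁻; ∈-allFin; ∈-applyUpTo⁺)
open import Data.List.Relation.Unary.Unique.Propositional using (Unique)
open import Data.List.Relation.Unary.Unique.Propositional.Properties using (filter⁺)
open import Data.List.Relation.Unary.AllPairs using ([]; _∷_)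
open import Data.List.Relation.Unary.Any using (here; there)
import Data.List.Relation.Unary.Any as Any
import Data.List.Relation.Unary.All as All
open import Data.Product using (_×_; Σ-syntax; _,_; proj₁; proj₂)
open import Data.Sum using (_⊎_; inj₁; inj₂; [_,_]′)
open import Function using (_∘_; id)
open import Level using (0ℓ)
open import Relation.Nullary using (¬_; Dec; yes; no; ¬?; contradiction)
open import Relation.Unary using (Pred; Decidable)
open import Relation.Unary.Properties using (∁?)
open import Relation.Binary using (DecidableEquality)
open import Relation.Binary.PropositionalEquality using (_≡_; _≢_; refl; sym; trans; cong; cong₂; subst; module ≡-Reasoning)

Subset : FinSet → (FinSet → Set) → Set
Subset S P = Σ[ C ∈ FinSet ] (Unique C × C ⊆ₛ S × P C)

widen : ∀ {S C P} → C ⊆ₛ S → Subset C P → Subset S P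
widen C⊆S (D , uD , D⊆C , p) = D , uD , C⊆S ∘ D⊆C , p

Homogeneous : (ℕ → ℕ → Set) → FinSet → Set
Homogeneous R B = ∀ {i j} → i ∈ B → j ∈ B → R i j

Homogeneous-⊆ : ∀ {R B C} → C ⊆ₛ B → Homogeneous R B → Homogeneous R C
Homogeneous-⊆ C⊆B hom i∈C j∈C = hom (C⊆B i∈C) (C⊆B j∈C)

Homogeneous-∷ : ∀ {R x B} → R x x → (∀ {j} → j ∈ B → R x j × R j x) →
                Homogeneous R B → Homogeneous R (x ∷ B)
Homogeneous-∷ rxx rx _ (here refl) (here refl) = rxx
Homogeneous-∷ rxx rx _ (here refl) (there j∈B) = proj₁ (rx j∈B)
Homogeneous-∷ rxx rx _ (there i∈B) (here refl) = proj₂ (rx i∈B)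
Homogeneous-∷ rxx rx hom (there i∈B) (there j∈B) = hom i∈B j∈B

filter-Subset : ∀ {P : Pred ℕ 0ℓ} (P? : Decidable P) {S} {Q : FinSet → Set} → Unique S →
                Q (filter P? S) → Subset S (λ C → Q C × (∀ {x} → x ∈ C → P x))
filter-Subset P? {S} uS q =
  filter P? S , filter⁺ P? uS , proj₁ ∘ ∈-filter⁻ P? {xs = S} , q , proj₂ ∘ ∈-filter⁻ P? {xs = S}

module _ {P : Pred ℕ 0ℓ} (P? : Decidable P) where

  length-filter+filter-∁ : ∀ xs → length (filter P? xs) + length (filter (∁? P?) xs) ≡ length xs
  length-filter+filter-∁ [] = refl
  length-filter+filter-∁ (x ∷ xs) with P? x
  ... | yes _ = cong suc (length-filter+filter-∁ xs)
  ... | no _  = trans (+-suc _ _) (cong suc (length-filter+filter-∁ xs))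

  partition-large : ∀ a b {S} → Unique S → a + b ≤ length S →
                    Subset S (λ C → a ≤ length C × (∀ {x} → x ∈ C → P x))
                  ⊎ Subset S (λ C → b < length C × (∀ {x} → x ∈ C → ¬ P x))
  partition-large a b {S} uS a+b≤S with a ≤? length (filter P? S)
  ... | yes a≤ = inj₁ (filter-Subset P? uS a≤)
  ... | no a≰ = inj₂ (filter-Subset (∁? P?) uS (+-cancelˡ-< a b _ a+b<a+rest))
    where
    a+b<a+rest : a + b < a + length (filter (∁? P?) S)
    a+b<a+rest = begin-strict
      a + b                                                    ≤⟨ a+b≤S ⟩
      length S                                                 ≡⟨ length-filter+filter-∁ S ⟨
      length (filter P? S) + length (filter (∁? P?) S)         <⟨ +-monoˡ-< _ (≰⇒> a≰) ⟩
      a + length (filter (∁? P?) S)                            ∎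
      where open ≤-Reasoning

module _ {A : Set} (_≟_ : DecidableEquality A) (colour : ℕ → A) where

  ColourClass : A → FinSet → Set
  ColourClass c C = ∀ {x} → x ∈ C → colour x ≡ c

  pigeonhole : ∀ n (cs : List A) {S} → Unique S → (∀ {x} → x ∈ S → colour x ∈ cs) →
               length cs * n < length S →
               Σ[ c ∈ A ] (c ∈ cs × Subset S (λ C → n < length C × ColourClass c C))
  pigeonhole n [] {x ∷ _} _ colour∈ _ with () ← colour∈ (here refl)
  pigeonhole n (c ∷ cs) uS colour∈ large
    with partition-large (λ x → colour x ≟ c) (suc n) (length cs * n) uS large
  ... | inj₁ class = c , here refl , class
  ... | inj₂ (C , uC , C⊆S , large′ , colour≢c) =
    let c′ , c′∈cs , D = pigeonhole n cs uC colour∈cs large′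
    in  c′ , there c′∈cs , widen C⊆S D
    where
    colour∈cs : ∀ {x} → x ∈ C → colour x ∈ cs
    colour∈cs x∈C with colour∈ (C⊆S x∈C)
    ... | here eq = contradiction eq (colour≢c x∈C)
    ... | there p = p

  pigeonhole-≤ : ∀ n c cs {S} → Unique S → (∀ {x} → x ∈ S → colour x ∈ c ∷ cs) →
                 length (c ∷ cs) * n ≤ length S →
                 Σ[ c′ ∈ A ] (c′ ∈ c ∷ cs × Subset S (λ C → n ≤ length C × ColourClass c′ C))
  pigeonhole-≤ zero c cs _ _ _ = c , here refl , [] , [] , (λ ()) , z≤n , λ ()
  pigeonhole-≤ (suc n) c cs uS colour∈ large =
    pigeonhole n (c ∷ cs) uS colour∈ (<-≤-trans (*-monoʳ-< (length (c ∷ cs)) (n<1+n n)) large)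

module _ {A : Set} (f : A → ℕ) where

  argmin-∈ : ∀ x xs → argmin f x xs ∈ x ∷ xs
  argmin-∈ x xs = [ here , there ]′ (argmin-sel f x xs)

  f[argmin]≤f[∈] : ∀ {x xs y} → y ∈ x ∷ xs → f (argmin f x xs) ≤ f y
  f[argmin]≤f[∈] {x} {xs} (here refl) = f[argmin]≤f[⊤] {f = f} x xs
  f[argmin]≤f[∈] {x} {xs} (there y∈xs) = All.lookup (f[argmin]≤f[xs] {f = f} x xs) y∈xs

max-∈ : ∀ x xs → max x xs ∈ x ∷ xs
max-∈ x xs = [ here , there ]′ (argmax-sel id x xs)

∈⇒≤max : ∀ {x xs y} → y ∈ x ∷ xs → y ≤ max x xs
∈⇒≤max {x} {xs} (here refl) = ⊥≤max x xs
∈⇒≤max {x} {xs} (there y∈xs) = All.lookup (xs≤max x xs) y∈xs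

module _ (ℓ : ℕ → ℕ) where

  -- Elements i are read as the intervals [i, ℓ i].
  Overlapping Disjoint : FinSet → Set
  Overlapping = Homogeneous (λ i j → j ≤ ℓ i)
  Disjoint = Homogeneous (λ i j → i < j → ℓ i < j)

  overlapping-or-disjoint : ∀ m p {S} → Unique S → (∀ {i} → i ∈ S → i ≤ ℓ i) → m * p ≤ length S →
                            Subset S (λ K → m ≤ length K × Overlapping K)
                          ⊎ Subset S (λ I → p ≤ length I × Disjoint I)
  overlapping-or-disjoint m zero _ _ _ = inj₂ ([] , [] , (λ ()) , z≤n , λ ())
  overlapping-or-disjoint m (suc p) {[]} _ _ large =
    inj₁ ([] , [] , (λ ()) , ≤-trans (m≤m*n m (suc p)) large , λ ())
  overlapping-or-disjoint m (suc p) {x ∷ xs} uS i≤ℓi large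
    with partition-large (λ s → max x xs ≤? ℓ s) m (m * p) uS
           (subst (_≤ length (x ∷ xs)) (*-suc m p) large)
  ... | inj₁ (K , uK , K⊆S , m≤K , t≤ℓ) =
    inj₁ (K , uK , K⊆S , m≤K , λ i∈K j∈K → ≤-trans (∈⇒≤max (K⊆S j∈K)) (t≤ℓ i∈K))
  ... | inj₂ (C , uC , C⊆S , large′ , ℓ<t)
    with overlapping-or-disjoint m p uC (i≤ℓi ∘ C⊆S) (<⇒≤ large′)
  ...   | inj₁ K = inj₁ (widen C⊆S K)
  ...   | inj₂ (I , uI , I⊆C , p≤I , disjoint) =
    inj₂ (t ∷ I , All.tabulate (λ j∈I → >⇒≢ (j<t j∈I)) ∷ uI , t∷I⊆S , s≤s p≤I ,
          Homogeneous-∷ (λ t<t → contradiction t<t (<-irrefl refl))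
                        (λ j∈I → (λ t<j → contradiction t<j (<⇒≯ (j<t j∈I))) , λ _ → ℓj<t j∈I)
                        disjoint)
    where
    -- t = max S lies beyond every interval [s, ℓ s] with s ∈ C, so it extends any disjoint family in C.
    t : ℕ
    t = max x xs
    ℓj<t : ∀ {j} → j ∈ I → ℓ j < t
    ℓj<t j∈I = ≰⇒> (ℓ<t (I⊆C j∈I))
    j<t : ∀ {j} → j ∈ I → j < t
    j<t j∈I = ≤-<-trans (i≤ℓi (C⊆S (I⊆C j∈I))) (ℓj<t j∈I)
    t∷I⊆S : (t ∷ I) ⊆ₛ (x ∷ xs)
    t∷I⊆S (here refl) = max-∈ x xs
    t∷I⊆S (there j∈I) = C⊆S (I⊆C j∈I)

length-allFin : ∀ n → length (allFin n) ≡ n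
length-allFin n = length-tabulate id

module _ {kstar : ℕ} (h : Fin kstar → ℕ → ℕ) where

  Long Short : Fin kstar → FinSet → Set
  Long k = Homogeneous (λ i j → i < j → h k i ≥ j)
  Short k = Homogeneous (λ i j → i < j → h k i < j)

  Above : FinSet → Set
  Above S = ∀ k i → i ∈ S → h k i ≥ i

  lowest : Fin kstar → List (Fin kstar) → ℕ → Fin kstar
  lowest r rs i = argmin (λ k → h k i) r rs

  long-or-short-step : ∀ {S} m q r rs → length (r ∷ rs) ≤ kstar → Unique S → Above S →
    m * (kstar * q) ≤ length S →
      Subset S (λ K → m ≤ length K × ∀ {k} → k ∈ r ∷ rs → Long k K)
    ⊎ Σ[ c ∈ Fin kstar ] (c ∈ r ∷ rs × Subset S (λ C → q ≤ length C × Short c C))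
  long-or-short-step m q r rs |R|≤k uS above large
    with overlapping-or-disjoint ℓ m (kstar * q) uS (λ {i} i∈S → above (lowest r rs i) i i∈S) large
    where
    ℓ : ℕ → ℕ
    ℓ i = h (lowest r rs i) i
  ... | inj₁ (K , uK , K⊆S , m≤K , overlapping) =
    inj₁ (K , uK , K⊆S , m≤K , λ k∈R i∈K j∈K _ →
      ≤-trans (overlapping i∈K j∈K) (f[argmin]≤f[∈] (λ k → h k _) k∈R))
  ... | inj₂ (I , uI , I⊆S , kq≤I , disjoint)
    with pigeonhole-≤ Fin._≟_ (lowest r rs) q r rs uI (λ {i} _ → argmin-∈ (λ k → h k i) r rs)
                      (≤-trans (*-monoˡ-≤ q |R|≤k) kq≤I)
  ...   | c , c∈R , C , uC , C⊆I , q≤C , lowest≡c =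
    inj₂ (c , c∈R , C , uC , I⊆S ∘ C⊆I , q≤C , λ {i} i∈C j∈C i<j →
      subst (λ k → h k i < _) (lowest≡c i∈C) (disjoint (C⊆I i∈C) (C⊆I j∈C) i<j))

  _≢?_ : (k c : Fin kstar) → Dec (k ≢ c)
  k ≢? c = ¬? (k Fin.≟ c)

  remove : Fin kstar → List (Fin kstar) → List (Fin kstar)
  remove c = filter (_≢? c)

  length-remove : ∀ {c R} → c ∈ R → length (remove c R) < length R
  length-remove {c} {R} c∈R = filter-notAll (_≢? c) R (Any.map (λ { refl c≢c → c≢c refl }) c∈R)

  settle : ∀ {c R S C} → C ⊆ₛ S → Short c C → (∀ k → k ∈ R ⊎ Short k S) →
           ∀ k → k ∈ remove c R ⊎ Short k C
  settle {c} C⊆S short settled k with settled k | k Fin.≟ c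
  ... | inj₂ shortₖ | _       = inj₂ (Homogeneous-⊆ C⊆S shortₖ)
  ... | inj₁ _      | yes refl = inj₂ short
  ... | inj₁ k∈R    | no k≢c  = inj₁ (∈-filter⁺ (_≢? c) k∈R k≢c)

  module _ (m : ℕ) .{{_ : NonZero m}} .{{_ : NonZero kstar}} where

    LongOrShort : FinSet → Set
    LongOrShort K = m ≤ length K × ∀ k → Long k K ⊎ Short k K

    -- R holds the indices not yet known to be short; each step settles all of them or removes one.
    long-or-short-iter : ∀ j R {S} → length R ≤ j → length R ≤ kstar → Unique S → Above S →
      m * (kstar * m) ^ j ≤ length S → (∀ k → k ∈ R ⊎ Short k S) → Subset S LongOrShort
    long-or-short-iter j [] {S} _ _ uS _ large settled =
      S , uS , id , ≤-trans (m≤m*n m ((kstar * m) ^ j) {{m^n≢0 _ j {{m*n≢0 kstar m}}}}) large ,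
      [ (λ ()) , inj₂ ]′ ∘ settled
    long-or-short-iter (suc j) (r ∷ rs) {S} |R|≤1+j |R|≤k uS above large settled
      with long-or-short-step m (m * (kstar * m) ^ j) r rs |R|≤k uS above
             (subst (_≤ length S) (cong (m *_) (*-assoc kstar m _)) large)
    ... | inj₁ (K , uK , K⊆S , m≤K , long) =
      K , uK , K⊆S , m≤K , λ k → [ inj₁ ∘ long , inj₂ ∘ Homogeneous-⊆ K⊆S ]′ (settled k)
    ... | inj₂ (c , c∈R , C , uC , C⊆S , large′ , short) =
      widen C⊆S (long-or-short-iter j (remove c (r ∷ rs))
        (≤-pred (<-≤-trans (length-remove c∈R) |R|≤1+j)) (≤-trans (<⇒≤ (length-remove c∈R)) |R|≤k)
        uC (λ k i → above k i ∘ C⊆S) large′ (settle C⊆S short settled))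

    long-or-short-subset : ∀ {S} → Unique S → Above S → m * (kstar * m) ^ kstar ≤ length S →
                           Subset S LongOrShort
    long-or-short-subset uS above large =
      long-or-short-iter kstar (allFin kstar) |allFin|≤kstar |allFin|≤kstar uS above large (inj₁ ∘ ∈-allFin)
      where
      |allFin|≤kstar : length (allFin kstar) ≤ kstar
      |allFin|≤kstar = ≤-reflexive (length-allFin kstar)

m*[n*m]^n≤[n*m]^[n+1] : ∀ m n .{{_ : NonZero n}} → m * (n * m) ^ n ≤ (n * m) ^ (n + 1)
m*[n*m]^n≤[n*m]^[n+1] m n =
  subst (m * (n * m) ^ n ≤_) (cong ((n * m) ^_) (+-comm 1 n)) (*-monoˡ-≤ ((n * m) ^ n) (m≤n*m m n))

constant-or-injective : ∀ (f : ℕ → ℕ) M N {S} → Unique S → M * N < length S →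
                          Subset S (λ C → M < length C × ConstantOn f C)
                        ⊎ Subset S (λ C → N < length C × InjectiveOn f C)
constant-or-injective f M zero {x ∷ _} _ _ =
  inj₂ (x ∷ [] , All.[] ∷ [] , (λ { (here refl) → here refl }) , s≤s z≤n ,
        λ { (here refl) (here refl) _ → refl })
constant-or-injective f M (suc N) {x ∷ xs} uS large
  with partition-large (λ y → f y ℕ.≟ f x) (suc M) (M * N) uS
         (subst (_< length (x ∷ xs)) (*-suc M N) large)
... | inj₁ (C , uC , C⊆S , M<C , f≡fx) =
  inj₁ (C , uC , C⊆S , M<C , λ i∈C j∈C → trans (f≡fx i∈C) (sym (f≡fx j∈C)))
... | inj₂ (C , uC , C⊆S , large′ , f≢fx) with constant-or-injective f M N uC large′
...   | inj₁ K = inj₁ (widen C⊆S K)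
...   | inj₂ (J , uJ , J⊆C , N<J , injective) =
  inj₂ (x ∷ J , All.tabulate (λ j∈J x≡j → f≢fx (J⊆C j∈J) (cong f (sym x≡j))) ∷ uJ , x∷J⊆S , s≤s N<J ,
        Homogeneous-∷ (λ _ → refl)
          (λ j∈J → (λ fx≡fj → contradiction (sym fx≡fj) (f≢fx (J⊆C j∈J)))
                 , (λ fj≡fx → contradiction fj≡fx (f≢fx (J⊆C j∈J))))
          injective)
  where
  x∷J⊆S : (x ∷ J) ⊆ₛ (x ∷ xs)
  x∷J⊆S (here refl) = here refl
  x∷J⊆S (there j∈J) = C⊆S (J⊆C j∈J)

module _ {K : Set} (P : K → FinSet → Set) (P-⊆ : ∀ {k B C} → C ⊆ₛ B → P k B → P k C)
         (Φ : ℕ → ℕ) {A : FinSet}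
         (step : ∀ k n {S} → Unique S → S ⊆ₛ A → Φ n < length S → Subset S (λ C → n < length C × P k C))
         where

  homogeneous-subset : ∀ ks n {S} → Unique S → S ⊆ₛ A → fold n Φ (length ks) < length S →
                       Subset S (λ C → n < length C × ∀ {k} → k ∈ ks → P k C)
  homogeneous-subset [] n {S} uS _ large = S , uS , id , large , λ ()
  homogeneous-subset (k ∷ ks) n uS S⊆A large with step k (fold n Φ (length ks)) uS S⊆A large
  ... | C , uC , C⊆S , large′ , Pk with homogeneous-subset ks n uC (S⊆A ∘ C⊆S) large′
  ...   | D , uD , D⊆C , n<D , Pks =
    D , uD , C⊆S ∘ D⊆C , n<D , λ { (here refl) → P-⊆ D⊆C Pk ; (there k∈ks) → Pks k∈ks }

fold-scale : ∀ d n k → fold n (d *_) k ≡ d ^ k * n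
fold-scale d n zero = sym (*-identityˡ n)
fold-scale d n (suc k) = trans (cong (d *_) (fold-scale d n k)) (sym (*-assoc d (d ^ k) n))

fold-square : ∀ n k → fold n (λ x → x * x) k ≡ n ^ (2 ^ k)
fold-square n zero = sym (*-identityʳ n)
fold-square n (suc k) = begin
  fold n (λ x → x * x) k * fold n (λ x → x * x) k ≡⟨ cong₂ _*_ (fold-square n k) (fold-square n k) ⟩
  n ^ (2 ^ k) * n ^ (2 ^ k)                       ≡⟨ ^-distribˡ-+-* n (2 ^ k) (2 ^ k) ⟨
  n ^ (2 ^ k + 2 ^ k)                             ≡⟨ cong (λ e → n ^ (2 ^ k + e)) (+-identityʳ (2 ^ k)) ⟨
  n ^ (2 ^ suc k)                                 ∎
  where open ≡-Reasoning

ConstantOrInjective : (ℕ → ℕ) → FinSet → Set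
ConstantOrInjective f C = ConstantOn f C ⊎ InjectiveOn f C

ConstantOrInjective-⊆ : ∀ {f B C} → C ⊆ₛ B → ConstantOrInjective f B → ConstantOrInjective f C
ConstantOrInjective-⊆ C⊆B = [ inj₁ ∘ Homogeneous-⊆ C⊆B , inj₂ ∘ Homogeneous-⊆ C⊆B ]′

constant-or-injective-square : ∀ (f : ℕ → ℕ) n {S} → Unique S → n * n < length S →
                               Subset S (λ C → n < length C × ConstantOrInjective f C)
constant-or-injective-square f n uS large with constant-or-injective f n n uS large
... | inj₁ (C , uC , C⊆S , n<C , constant)  = C , uC , C⊆S , n<C , inj₁ constant
... | inj₂ (C , uC , C⊆S , n<C , injective) = C , uC , C⊆S , n<C , inj₂ injective

∈-applyUpTo-suc : ∀ {d x} → 1 ≤ x → x ≤ d → x ∈ applyUpTo suc d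
∈-applyUpTo-suc {x = suc x} _ x<d = ∈-applyUpTo⁺ suc x<d

constant-subset : ∀ (g : ℕ → ℕ) d n {A S} → (∀ i → i ∈ A → 1 ≤ g i × g i ≤ d) →
                  Unique S → S ⊆ₛ A → d * n < length S → Subset S (λ C → n < length C × ConstantOn g C)
constant-subset g d n {S = S} g∈[1,d] uS S⊆A large
  with pigeonhole ℕ._≟_ g n (applyUpTo suc d) uS
         (λ {i} i∈S → let 1≤gi , gi≤d = g∈[1,d] i (S⊆A i∈S) in ∈-applyUpTo-suc 1≤gi gi≤d)
         (subst (λ l → l * n < length S) (sym (length-applyUpTo suc d)) large)
... | _ , _ , C , uC , C⊆S , n<C , g≡c = C , uC , C⊆S , n<C , λ i∈C j∈C → trans (g≡c i∈C) (sym (g≡c j∈C))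

canonical-subset : ∀ {kstar} d m (g f : Fin kstar → ℕ → ℕ) {A} → Unique A →
  (∀ k i → i ∈ A → 1 ≤ g k i × g k i ≤ d) → d ^ kstar * m ^ (2 ^ kstar) < length A →
  Subset A (λ C → m < length C × ∀ k → ConstantOrInjective (f k) C × ConstantOn (g k) C)
canonical-subset {kstar} d m g f {A} uA g∈[1,d] large =
  let C , uC , C⊆A , large′ , g-constant =
        homogeneous-subset (λ k → ConstantOn (g k)) Homogeneous-⊆ (d *_)
          (λ k n → constant-subset (g k) d n (g∈[1,d] k))
          (allFin kstar) (m ^ (2 ^ kstar)) uA id (subst (_< length A) (sym g-rounds) large)
      D , uD , D⊆C , m<D , f-canonical =
        homogeneous-subset (λ k → ConstantOrInjective (f k)) ConstantOrInjective-⊆ (λ x → x * x)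
          (λ k n uS _ → constant-or-injective-square (f k) n uS)
          (allFin kstar) m uC id (subst (_< length C) (sym f-rounds) large′)
  in D , uD , C⊆A ∘ D⊆C , m<D ,
     λ k → f-canonical (∈-allFin k) , Homogeneous-⊆ D⊆C (g-constant (∈-allFin k))
  where
  g-rounds : fold (m ^ (2 ^ kstar)) (d *_) (length (allFin kstar)) ≡ d ^ kstar * m ^ (2 ^ kstar)
  g-rounds = trans (cong (fold _ (d *_)) (length-allFin kstar)) (fold-scale d _ kstar)
  f-rounds : fold m (λ x → x * x) (length (allFin kstar)) ≡ m ^ (2 ^ kstar)
  f-rounds = trans (cong (fold m (λ x → x * x)) (length-allFin kstar)) (fold-square m kstar)

claim1p4 :
    -- Part (1)
    (∀ (kstar m0 m1 : ℕ) → kstar ≥ 1 → m0 ≥ 1 → m1 ≥ (kstar * m0) ^ (kstar + 1) →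
      ∀ (A' : FinSet) → Unique A' → length A' ≥ m1 →
      ∀ (h : Fin kstar → ℕ → ℕ) → (∀ k i → i ∈ A' → h k i ≥ i) →
      Σ[ A'' ∈ FinSet ] (Unique A'' × A'' ⊆ₛ A' × length A'' ≥ m0 ×
        (∀ k → (∀ {i j} → i ∈ A'' → j ∈ A'' → i < j → h k i ≥ j)
             ⊎ (∀ {i j} → i ∈ A'' → j ∈ A'' → i < j → h k i < j))))
    ×
    -- Part (2)
    (∀ (kstar d m0 m1 : ℕ) → kstar ≥ 1 → d ≥ 1 → m0 ≥ 1 →
      m1 > d ^ kstar * m0 ^ (2 ^ kstar) →
      ∀ (A : FinSet) → Unique A → length A > m1 →
      ∀ (g f : Fin kstar → ℕ → ℕ) → (∀ k i → i ∈ A → 1 ≤ g k i × g k i ≤ d) →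
      Σ[ A' ∈ FinSet ] (Unique A' × A' ⊆ₛ A × length A' > m0 ×
        (∀ k → (ConstantOn (f k) A' ⊎ InjectiveOn (f k) A') × ConstantOn (g k) A')))
claim1p4 =
  (λ kstar m0 m1 kstar≥1 m0≥1 m1≤ A' uA' m1≤A' h above →
    let instance
          _ = >-nonZero kstar≥1
          _ = >-nonZero m0≥1
    in long-or-short-subset h m0 uA' above
         (≤-trans (m*[n*m]^n≤[n*m]^[n+1] m0 kstar) (≤-trans m1≤ m1≤A')))
  , λ kstar d m0 m1 _ _ _ m1> A uA m1<A g f g∈[1,d] →
      canonical-subset d m0 g f uA g∈[1,d] (<-trans m1> m1<A)
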